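{- Let $d\ge3$ be an integer and let $a,u,v$ be real numbers with $2<a<4$ satisfying $$v>2a-\frac{a^2}{2}+\max\!\Big(0,\frac{(d-1)a^2}{d^2}-\frac{2a}{d}\Big)-2u.$$ Then for all sufficiently large integers $k$ such that $n=ak$, $s^{n,k}=a(ak+1)/2$, $e=uk$ and $f=vk$ are integers, the following two conditions hold, where $c=s^{n,k}-n$, $C=\{x\in[n]:x\ge c\}$ and $h=|C|-2e=2(n-e)-s^{n,k}+1$: (a) $f>h$; and (b) $\sum_{i=c-d(f-h)}^{c-1}i<(f-h)\,s^{n,k}$.
   Context: $[n]=\{1,\dots,n\}$ and $s^{n,k}=\frac{n(n+1)}{2k}$.
   Formalization: The parameters a, u and v are taken to be rational numbers rather than real numbers. -}

module Defs where

open import Data.Nat as ℕ using (ℕ; zero; suc)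
open import Data.Integer as ℤ using (ℤ; +_; ∣_∣)
import Data.Integer.Properties as ℤP
open import Data.Rational using (ℚ; _/_; 0ℚ)
open import Data.List using (List; []; _∷_; map; upTo; filter; length; sum)
open import Data.Bool using (if_then_else_)
open import Relation.Nullary.Decidable using (does)

ιℕ : ℕ → ℚ
ιℕ n = + n / 1

ιℤ : ℤ → ℚ
ιℤ z = z / 1

recipℕ : ℕ → ℚ
recipℕ zero    = 0ℚ
recipℕ (suc m) = + 1 / suc m

[_] : ℤ → List ℤ
[ n ] = map (λ i → + suc i) (upTo ∣ n ∣)

cardC : ℤ → ℤ → ℤ
cardC n c = + length (filter (λ x → c ℤ.≤? x) [ n ])

sumFrom : ℤ → ℕ → ℤ
sumFrom lo zero    = + 0
sumFrom lo (suc m) = sumFrom lo m ℤ.+ (lo ℤ.+ + m)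

sumFromTo : ℤ → ℤ → ℤ
sumFromTo lo hi =
  if does (lo ℤ.≤? hi) then sumFrom lo ∣ (hi ℤ.+ + 1) ℤ.- lo ∣ else + 0

-- With n = ak, s = a(ak+1)/2, e = uk and f = vk every quantity in the statement is an
-- affine function of k.  Once (4 - a)k ≥ 1 we have 0 < c ≤ n, so |C| = n - c + 1 and
-- f - h = δk + (a/2 - 1), where the slack δ = v - (2a - a²/2 - 2u) exceeds both 0 and the
-- threshold X = (d-1)a²/d² - 2a/d; hence f - h > 0, which is (a).  The sum in (b) is
-- d(f-h)(2c - d(f-h) - 1)/2, so (b) says d(2c - d(f-h) - 1) < 2s, and the difference of the
-- two sides is affine in k with slope d²(δ - X) > 0, hence positive for large k.

module Submission where

open import Defs
open import Data.Nat as ℕ using (ℕ)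
open import Data.Integer as ℤ using (ℤ; +_)
open import Data.Rational using (ℚ; _<_; _+_; _-_; _*_; _⊔_; ½; 0ℚ)
open import Data.Product using (Σ; ∃; _×_; _,_)
open import Relation.Binary.PropositionalEquality using (_≡_)

open import Data.Nat using (zero; suc; _∸_; s≤s; z≤n)
import Data.Nat.Properties as ℕP
open import Data.Integer using (+[1+_]; -[1+_]; +≤+; +<+; -≤+; -<+)
import Data.Integer.Properties as ℤP
open import Data.Integer.Tactic.RingSolver using () renaming (ring to ℤ-ring)
open import Data.Rational as ℚ using (mkℚ; 1ℚ; -_; _≤_; _≟_; *<*; *≤*; 1/_; positive; nonNegative)
open import Data.Rational.Literals using (fromℤ)
import Data.Rational.Properties as ℚP
open import Data.List using ([]; _∷_; _∷ʳ_; _++_; map; filter; length; upTo)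
import Data.List.Properties as ListP
open import Relation.Nullary using (yes; no; ¬_)
open import Relation.Unary using (Decidable)
open import Relation.Nullary.Decidable using (dec⇒maybe; dec-true; dec-false)
open import Relation.Binary.PropositionalEquality
  using (refl; sym; trans; cong; cong₂; subst; subst₂; module ≡-Reasoning)
open import Level using (0ℓ)
open import Tactic.RingSolver using (solve-∀; solve)
open import Tactic.RingSolver.Core.AlmostCommutativeRing using (AlmostCommutativeRing; fromCommutativeRing)

ℚ-ring : AlmostCommutativeRing 0ℓ 0ℓ
ℚ-ring = fromCommutativeRing ℚP.+-*-commutativeRing (λ x → dec⇒maybe (0ℚ ≟ x))

ιℤ≡fromℤ : ∀ z → ιℤ z ≡ fromℤ z
ιℤ≡fromℤ z = ℚP.↥p/↧p≡p (fromℤ z)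

ιℤ-homo-+ : ∀ x y → ιℤ (x ℤ.+ y) ≡ ιℤ x + ιℤ y
ιℤ-homo-+ x y rewrite ιℤ≡fromℤ x | ιℤ≡fromℤ y =
  cong (ℚ._/ 1) (cong₂ ℤ._+_ (sym (ℤP.*-identityʳ x)) (sym (ℤP.*-identityʳ y)))

ιℤ-homo-* : ∀ x y → ιℤ (x ℤ.* y) ≡ ιℤ x * ιℤ y
ιℤ-homo-* x y rewrite ιℤ≡fromℤ x | ιℤ≡fromℤ y = refl

ιℤ-homo‿- : ∀ x → ιℤ (ℤ.- x) ≡ - ιℤ x
ιℤ-homo‿- x rewrite ιℤ≡fromℤ x | ιℤ≡fromℤ (ℤ.- x) = fromℤ-homo‿- x
  where
  fromℤ-homo‿- : ∀ x → fromℤ (ℤ.- x) ≡ - fromℤ x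
  fromℤ-homo‿- (+ 0)      = refl
  fromℤ-homo‿- +[1+ _ ]  = refl
  fromℤ-homo‿- -[1+ _ ]  = refl

ιℤ-homo-minus : ∀ x y → ιℤ (x ℤ.- y) ≡ ιℤ x - ιℤ y
ιℤ-homo-minus x y = trans (ιℤ-homo-+ x (ℤ.- y)) (cong (_+_ (ιℤ x)) (ιℤ-homo‿- y))

ιℤ-mono-< : ∀ {x y} → x ℤ.< y → ιℤ x < ιℤ y
ιℤ-mono-< {x} {y} x<y rewrite ιℤ≡fromℤ x | ιℤ≡fromℤ y =
  *<* (subst₂ ℤ._<_ (sym (ℤP.*-identityʳ x)) (sym (ℤP.*-identityʳ y)) x<y)

ιℤ-mono-≤ : ∀ {x y} → x ℤ.≤ y → ιℤ x ≤ ιℤ y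
ιℤ-mono-≤ {x} {y} x≤y rewrite ιℤ≡fromℤ x | ιℤ≡fromℤ y =
  *≤* (subst₂ ℤ._≤_ (sym (ℤP.*-identityʳ x)) (sym (ℤP.*-identityʳ y)) x≤y)

ιℤ-cancel-< : ∀ {x y} → ιℤ x < ιℤ y → x ℤ.< y
ιℤ-cancel-< {x} {y} ιx<ιy rewrite ιℤ≡fromℤ x | ιℤ≡fromℤ y with ιx<ιy
... | *<* x*1<y*1 = subst₂ ℤ._<_ (ℤP.*-identityʳ x) (ℤP.*-identityʳ y) x*1<y*1

ιℤ-cancel-≤ : ∀ {x y} → ιℤ x ≤ ιℤ y → x ℤ.≤ y
ιℤ-cancel-≤ {x} {y} ιx≤ιy rewrite ιℤ≡fromℤ x | ιℤ≡fromℤ y with ιx≤ιy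
... | *≤* x*1≤y*1 = subst₂ ℤ._≤_ (ℤP.*-identityʳ x) (ℤP.*-identityʳ y) x*1≤y*1

ιℕ-pred : ∀ n → ιℕ n ≡ ιℕ (suc n) - 1ℚ
ιℕ-pred n = ιℤ-homo-minus (+ suc n) (+ 1)

ιℕ*recipℕ : ∀ n → ιℕ (suc n) * recipℕ (suc n) ≡ 1ℚ
ιℕ*recipℕ n = trans (cong₂ _*_ (ιℤ≡fromℤ (+ suc n)) (ℚP.↥p/↧p≡p (1/ fromℤ (+ suc n))))
                    (ℚP.*-inverseʳ (fromℤ (+ suc n)))

p<q⇒0<q-p : ∀ {p q} → p < q → 0ℚ < q - p
p<q⇒0<q-p {p} {q} p<q = subst (_< q - p) (ℚP.+-inverseʳ p) (ℚP.+-monoˡ-< (- p) p<q)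

0<q-p⇒p<q : ∀ {p q} → 0ℚ < q - p → p < q
0<q-p⇒p<q {p} {q} 0<q-p =
  subst₂ _<_ (ℚP.+-identityʳ p) (p+[q-p]≡q p q) (ℚP.+-monoʳ-< p 0<q-p)
  where
  p+[q-p]≡q : ∀ p q → p + (q - p) ≡ q
  p+[q-p]≡q = solve-∀ ℚ-ring

p+q-r<s⇒q<s-[p-r] : ∀ {p q r s} → p + q - r < s → q < s - (p - r)
p+q-r<s⇒q<s-[p-r] {p} {q} {r} {s} p+q-r<s =
  0<q-p⇒p<q (subst (0ℚ <_) (rearrange p q r s) (p<q⇒0<q-p p+q-r<s))
  where
  rearrange : ∀ p q r s → s - (p + q - r) ≡ s - (p - r) - q
  rearrange = solve-∀ ℚ-ring

*-pos : ∀ {p q} → 0ℚ < p → 0ℚ < q → 0ℚ < p * q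
*-pos {p} {q} 0<p 0<q =
  ℚP.positive⁻¹ (p * q) {{ℚP.pos*pos⇒pos p {{positive 0<p}} q {{positive 0<q}}}}

*-nonNeg : ∀ {p q} → 0ℚ ≤ p → 0ℚ ≤ q → 0ℚ ≤ p * q
*-nonNeg {p} {q} 0≤p 0≤q =
  ℚP.nonNegative⁻¹ (p * q) {{ℚP.nonNeg*nonNeg⇒nonNeg p {{nonNegative 0≤p}} q {{nonNegative 0≤q}}}}

+-nonNeg-pos : ∀ {p q} → 0ℚ ≤ p → 0ℚ < q → 0ℚ < p + q
+-nonNeg-pos {p} {q} 0≤p 0<q = subst (_< p + q) (ℚP.+-identityʳ 0ℚ) (ℚP.+-mono-≤-< 0≤p 0<q)

Eventually : (ℕ → Set) → Set
Eventually P = ∃ λ K → ∀ k → K ℕ.≤ k → P k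

eventually-× : ∀ {P Q} → Eventually P → Eventually Q → Eventually (λ k → P k × Q k)
eventually-× (K , P-from-K) (L , Q-from-L) = K ℕ.⊔ L , λ k K⊔L≤k →
  P-from-K k (ℕP.m⊔n≤o⇒m≤o K L K⊔L≤k) , Q-from-L k (ℕP.m⊔n≤o⇒n≤o K L K⊔L≤k)

eventually-mono : ∀ {P Q} → (∀ k → P k → Q k) → Eventually P → Eventually Q
eventually-mono P⇒Q (K , P-from-K) = K , λ k K≤k → P⇒Q k (P-from-K k K≤k)

archimedean : ∀ q → Eventually (λ k → q < ιℕ k)
archimedean q@(mkℚ z den-1 _) = N , λ k N≤k →
  ℚP.<-≤-trans q<N (ιℤ-mono-≤ (+≤+ N≤k))
  where
  N : ℕ
  N = suc ℤ.∣ z ∣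
  z≤∣z∣ : ∀ z → z ℤ.≤ + ℤ.∣ z ∣
  z≤∣z∣ (+ _)    = ℤP.≤-refl
  z≤∣z∣ -[1+ _ ] = -≤+
  z*1<N*den : z ℤ.* + 1 ℤ.< + N ℤ.* + suc den-1
  z*1<N*den = subst₂ ℤ._<_ (sym (ℤP.*-identityʳ z)) (ℤP.pos-* N (suc den-1))
    (ℤP.≤-<-trans (z≤∣z∣ z) (+<+ (ℕP.m≤m*n N (suc den-1))))
  q<N : q < ιℕ N
  q<N = subst (q <_) (sym (ιℤ≡fromℤ (+ N))) (*<* z*1<N*den)

affine-eventually-pos : ∀ α β → 0ℚ < α → Eventually (λ k → 0ℚ < α * ιℕ k + β)
affine-eventually-pos α β 0<α = eventually-mono beyond-root (archimedean (- β * 1/ α))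
  where
  instance
    α-pos : ℚ.Positive α
    α-pos = positive 0<α
    α≢0 : ℚ.NonZero α
    α≢0 = ℚP.pos⇒nonZero α
  α*root≡-β : α * (- β * 1/ α) ≡ - β
  α*root≡-β = begin
    α * (- β * 1/ α)  ≡⟨ x[yz]≡[xz]y α (- β) (1/ α) ⟩
    (α * 1/ α) * - β  ≡⟨ cong (_* - β) (ℚP.*-inverseʳ α) ⟩
    1ℚ * - β          ≡⟨ ℚP.*-identityˡ (- β) ⟩
    - β               ∎
    where
    open ≡-Reasoning
    x[yz]≡[xz]y : ∀ x y z → x * (y * z) ≡ (x * z) * y
    x[yz]≡[xz]y = solve-∀ ℚ-ring
  beyond-root : ∀ k → - β * 1/ α < ιℕ k → 0ℚ < α * ιℕ k + β
  beyond-root k root<k =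
    subst (0ℚ <_) (x-[-y]≡x+y (α * ιℕ k) β)
      (p<q⇒0<q-p (subst (_< α * ιℕ k) α*root≡-β (ℚP.*-monoʳ-<-pos α root<k)))
    where
    x-[-y]≡x+y : ∀ x y → x - - y ≡ x + y
    x-[-y]≡x+y = solve-∀ ℚ-ring

[1+N]≡[N]∷ʳ1+N : ∀ N → [ + suc N ] ≡ [ + N ] ∷ʳ + suc N
[1+N]≡[N]∷ʳ1+N N = trans (cong (map +1+) (sym (ListP.upTo-∷ʳ N))) (ListP.map-++ +1+ (upTo N) (N ∷ []))
  where
  +1+ : ℕ → ℤ
  +1+ i = + suc i

count-≥ : ∀ j N → length (filter (+[1+ j ] ℤ.≤?_) [ + N ]) ≡ N ∸ j
count-≥ j zero    = sym (ℕP.0∸n≡0 j)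
count-≥ j (suc N) = begin
  length (filter P? [ + suc N ])
    ≡⟨ cong (λ xs → length (filter P? xs)) ([1+N]≡[N]∷ʳ1+N N) ⟩
  length (filter P? ([ + N ] ++ + suc N ∷ []))
    ≡⟨ cong length (ListP.filter-++ P? [ + N ] (+ suc N ∷ [])) ⟩
  length (filter P? [ + N ] ++ filter P? (+ suc N ∷ []))
    ≡⟨ ListP.length-++ (filter P? [ + N ]) ⟩
  length (filter P? [ + N ]) ℕ.+ length (filter P? (+ suc N ∷ []))
    ≡⟨ cong (ℕ._+ length (filter P? (+ suc N ∷ []))) (count-≥ j N) ⟩
  (N ∸ j) ℕ.+ length (filter P? (+ suc N ∷ []))
    ≡⟨ new-element ⟩
  suc N ∸ j
    ∎
  where
  open ≡-Reasoning
  P? : Decidable (+[1+ j ] ℤ.≤_)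
  P? = +[1+ j ] ℤ.≤?_
  new-element : (N ∸ j) ℕ.+ length (filter P? (+ suc N ∷ [])) ≡ suc N ∸ j
  new-element with j ℕ.≤? N
  ... | yes j≤N = begin
    (N ∸ j) ℕ.+ length (filter P? (+ suc N ∷ []))  ≡⟨ cong (λ xs → (N ∸ j) ℕ.+ length xs) accepted ⟩
    (N ∸ j) ℕ.+ 1                                  ≡⟨ ℕP.+-comm (N ∸ j) 1 ⟩
    suc (N ∸ j)                                    ≡⟨ ℕP.+-∸-assoc 1 j≤N ⟨
    suc N ∸ j                                      ∎
    where
    accepted : filter P? (+ suc N ∷ []) ≡ + suc N ∷ []
    accepted = ListP.filter-accept P? {xs = []} (+≤+ (s≤s j≤N))
  ... | no j≰N = begin
    (N ∸ j) ℕ.+ length (filter P? (+ suc N ∷ []))  ≡⟨ cong (λ xs → (N ∸ j) ℕ.+ length xs) rejected ⟩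
    (N ∸ j) ℕ.+ 0                                  ≡⟨ ℕP.+-identityʳ (N ∸ j) ⟩
    N ∸ j                                          ≡⟨ ℕP.m≤n⇒m∸n≡0 (ℕP.<⇒≤ N<j) ⟩
    0                                              ≡⟨ ℕP.m≤n⇒m∸n≡0 N<j ⟨
    suc N ∸ j                                      ∎
    where
    N<j : N ℕ.< j
    N<j = ℕP.≰⇒> j≰N
    j≰1+N : ¬ (+[1+ j ] ℤ.≤ + suc N)
    j≰1+N (+≤+ (s≤s j≤N)) = j≰N j≤N
    rejected : filter P? (+ suc N ∷ []) ≡ []
    rejected = ListP.filter-reject P? {xs = []} j≰1+N

cardC≡ : ∀ n c → + 0 ℤ.< c → c ℤ.≤ n → cardC n c ≡ (n ℤ.- c) ℤ.+ + 1
cardC≡ (+ N) +[1+ j ] _ (+≤+ j<N) = begin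
  cardC (+ N) +[1+ j ]             ≡⟨ cong +_ (count-≥ j N) ⟩
  + (N ∸ j)                        ≡⟨ ℤP.⊖-≥ (ℕP.<⇒≤ j<N) ⟨
  N ℤ.⊖ j                          ≡⟨ ℤP.m-n≡m⊖n N j ⟨
  + N ℤ.- + j                      ≡⟨ x-y≡[x-[1+y]]+1 (+ N) (+ j) ⟩
  (+ N ℤ.- + suc j) ℤ.+ + 1        ∎
  where
  open ≡-Reasoning
  x-y≡[x-[1+y]]+1 : ∀ x y → x ℤ.- y ≡ (x ℤ.- (+ 1 ℤ.+ y)) ℤ.+ + 1
  x-y≡[x-[1+y]]+1 = solve-∀ ℤ-ring
cardC≡ _        (+ 0)     (+<+ ()) _
cardC≡ -[1+ _ ] +[1+ _ ] _        ()

sumFrom-double : ∀ lo L → + 2 ℤ.* sumFrom lo L ≡ + L ℤ.* (+ 2 ℤ.* lo ℤ.+ + L ℤ.- + 1)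
sumFrom-double lo zero    = refl
sumFrom-double lo (suc L) = begin
  + 2 ℤ.* (sumFrom lo L ℤ.+ (lo ℤ.+ + L))
    ≡⟨ ℤP.*-distribˡ-+ (+ 2) (sumFrom lo L) (lo ℤ.+ + L) ⟩
  + 2 ℤ.* sumFrom lo L ℤ.+ + 2 ℤ.* (lo ℤ.+ + L)
    ≡⟨ cong (ℤ._+ + 2 ℤ.* (lo ℤ.+ + L)) (sumFrom-double lo L) ⟩
  + L ℤ.* (+ 2 ℤ.* lo ℤ.+ + L ℤ.- + 1) ℤ.+ + 2 ℤ.* (lo ℤ.+ + L)
    ≡⟨ gauss-step lo (+ L) ⟩
  (+ 1 ℤ.+ + L) ℤ.* (+ 2 ℤ.* lo ℤ.+ (+ 1 ℤ.+ + L) ℤ.- + 1)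
    ∎
  where
  open ≡-Reasoning
  gauss-step : ∀ lo l → l ℤ.* (+ 2 ℤ.* lo ℤ.+ l ℤ.- + 1) ℤ.+ + 2 ℤ.* (lo ℤ.+ l)
                      ≡ (+ 1 ℤ.+ l) ℤ.* (+ 2 ℤ.* lo ℤ.+ (+ 1 ℤ.+ l) ℤ.- + 1)
  gauss-step = solve-∀ ℤ-ring

sumFromTo-≤ : ∀ {lo hi} → lo ℤ.≤ hi → sumFromTo lo hi ≡ sumFrom lo ℤ.∣ hi ℤ.+ + 1 ℤ.- lo ∣
sumFromTo-≤ {lo} {hi} lo≤hi rewrite dec-true (lo ℤ.≤? hi) lo≤hi = refl

sumFromTo-> : ∀ {lo hi} → hi ℤ.< lo → sumFromTo lo hi ≡ + 0
sumFromTo-> {lo} {hi} hi<lo rewrite dec-false (lo ℤ.≤? hi) (ℤP.<⇒≱ hi<lo) = refl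

sumFromTo-below : ∀ c L → + 2 ℤ.* sumFromTo (c ℤ.- + L) (c ℤ.- + 1) ≡ + L ℤ.* (+ 2 ℤ.* c ℤ.- + L ℤ.- + 1)
sumFromTo-below c zero    = cong (+ 2 ℤ.*_) (sumFromTo-> (ℤP.+-monoʳ-< c -<+))
sumFromTo-below c (suc L) = begin
  + 2 ℤ.* sumFromTo lo (c ℤ.- + 1)
    ≡⟨ cong (+ 2 ℤ.*_) (sumFromTo-≤ lo≤c-1) ⟩
  + 2 ℤ.* sumFrom lo ℤ.∣ c ℤ.- + 1 ℤ.+ + 1 ℤ.- lo ∣
    ≡⟨ cong (λ t → + 2 ℤ.* sumFrom lo ℤ.∣ t ∣) (length≡ c (+ suc L)) ⟩
  + 2 ℤ.* sumFrom lo (suc L)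
    ≡⟨ sumFrom-double lo (suc L) ⟩
  + suc L ℤ.* (+ 2 ℤ.* lo ℤ.+ + suc L ℤ.- + 1)
    ≡⟨ shift c (+ suc L) ⟩
  + suc L ℤ.* (+ 2 ℤ.* c ℤ.- + suc L ℤ.- + 1)
    ∎
  where
  open ≡-Reasoning
  lo : ℤ
  lo = c ℤ.- + suc L
  lo≤c-1 : lo ℤ.≤ c ℤ.- + 1
  lo≤c-1 = ℤP.+-monoʳ-≤ c (ℤP.neg-mono-≤ (+≤+ (s≤s z≤n)))
  length≡ : ∀ c l → c ℤ.- + 1 ℤ.+ + 1 ℤ.- (c ℤ.- l) ≡ l
  length≡ = solve-∀ ℤ-ring
  shift : ∀ c l → l ℤ.* (+ 2 ℤ.* (c ℤ.- l) ℤ.+ l ℤ.- + 1) ≡ l ℤ.* (+ 2 ℤ.* c ℤ.- l ℤ.- + 1)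
  shift = solve-∀ ℤ-ring

sumFromTo-below-< : ∀ d c m s → + 0 ℤ.< m → + d ℤ.* (+ 2 ℤ.* c ℤ.- + d ℤ.* m ℤ.- + 1) ℤ.< + 2 ℤ.* s →
                    sumFromTo (c ℤ.- + d ℤ.* m) (c ℤ.- + 1) ℤ.< m ℤ.* s
sumFromTo-below-< d c m@(+[1+ _ ]) s _ gap = ℤP.*-cancelˡ-<-nonNeg (+ 2) (begin-strict
  + 2 ℤ.* sumFromTo (c ℤ.- + d ℤ.* m) (c ℤ.- + 1)
    ≡⟨ cong (λ t → + 2 ℤ.* sumFromTo (c ℤ.- t) (c ℤ.- + 1)) dm≡ ⟨
  + 2 ℤ.* sumFromTo (c ℤ.- + dm) (c ℤ.- + 1)
    ≡⟨ sumFromTo-below c dm ⟩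
  + dm ℤ.* (+ 2 ℤ.* c ℤ.- + dm ℤ.- + 1)
    ≡⟨ cong (λ t → t ℤ.* (+ 2 ℤ.* c ℤ.- t ℤ.- + 1)) dm≡ ⟩
  + d ℤ.* m ℤ.* (+ 2 ℤ.* c ℤ.- + d ℤ.* m ℤ.- + 1)
    ≡⟨ [xy]z≡y[xz] (+ d) m _ ⟩
  m ℤ.* (+ d ℤ.* (+ 2 ℤ.* c ℤ.- + d ℤ.* m ℤ.- + 1))
    <⟨ ℤP.*-monoˡ-<-pos m gap ⟩
  m ℤ.* (+ 2 ℤ.* s)
    ≡⟨ x[yz]≡y[xz] m (+ 2) s ⟩
  + 2 ℤ.* (m ℤ.* s)
    ∎)
  where
  open ℤP.≤-Reasoning
  dm : ℕ
  dm = d ℕ.* ℤ.∣ m ∣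
  dm≡ : + dm ≡ + d ℤ.* m
  dm≡ = ℤP.pos-* d ℤ.∣ m ∣
  [xy]z≡y[xz] : ∀ x y z → x ℤ.* y ℤ.* z ≡ y ℤ.* (x ℤ.* z)
  [xy]z≡y[xz] = solve-∀ ℤ-ring
  x[yz]≡y[xz] : ∀ x y z → x ℤ.* (y ℤ.* z) ≡ y ℤ.* (x ℤ.* z)
  x[yz]≡y[xz] = solve-∀ ℤ-ring
sumFromTo-below-< _ _ (+ 0) _ (+<+ ()) _

threshold : ℕ → ℚ → ℚ
threshold d a = (ιℕ (d ∸ 1) * (a * a)) * (recipℕ d * recipℕ d) - (ιℕ 2 * a) * recipℕ d

scaled-threshold : ∀ {d} → 1 ℕ.≤ d → ∀ a →
  ιℕ d * ιℕ d * threshold d a ≡ (ιℕ d - 1ℚ) * (a * a) - ιℕ 2 * a * ιℕ d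
scaled-threshold {suc n} _ a = begin
  D * D * ((ιℕ n * (a * a)) * (R * R) - (ιℕ 2 * a) * R)
    ≡⟨ cong (λ t → D * D * ((t * (a * a)) * (R * R) - (ιℕ 2 * a) * R)) (ιℕ-pred n) ⟩
  D * D * (((D - 1ℚ) * (a * a)) * (R * R) - (ιℕ 2 * a) * R)
    ≡⟨ regroup D R a ⟩
  (D - 1ℚ) * (a * a) * ((D * R) * (D * R)) - ιℕ 2 * a * D * (D * R)
    ≡⟨ cong (λ t → (D - 1ℚ) * (a * a) * (t * t) - ιℕ 2 * a * D * t) (ιℕ*recipℕ n) ⟩
  (D - 1ℚ) * (a * a) * (1ℚ * 1ℚ) - ιℕ 2 * a * D * 1ℚ
    ≡⟨ drop-ones D a ⟩
  (D - 1ℚ) * (a * a) - ιℕ 2 * a * D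
    ∎
  where
  open ≡-Reasoning
  D : ℚ
  D = ιℕ (suc n)
  R : ℚ
  R = recipℕ (suc n)
  regroup : ∀ D R a → D * D * (((D - 1ℚ) * (a * a)) * (R * R) - (ιℕ 2 * a) * R)
                    ≡ (D - 1ℚ) * (a * a) * ((D * R) * (D * R)) - ιℕ 2 * a * D * (D * R)
  regroup = solve-∀ ℚ-ring
  drop-ones : ∀ D a → (D - 1ℚ) * (a * a) * (1ℚ * 1ℚ) - ιℕ 2 * a * D * 1ℚ
                    ≡ (D - 1ℚ) * (a * a) - ιℕ 2 * a * D
  drop-ones = solve-∀ ℚ-ring

module _ (d : ℕ) (a u v : ℚ) where

  D : ℚ
  D = ιℕ d

  slack : ℚ
  slack = v - (ιℕ 2 * a - ½ * (a * a) - ιℕ 2 * u)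

  gap-slope : ℚ
  gap-slope = D * D * slack - ((D - 1ℚ) * (a * a) - ιℕ 2 * a * D)

  gap-offset : ℚ
  gap-offset = a - D * ((a - 1ℚ) - D * (a * ½ - 1ℚ))

  gap-slope-pos : 1 ℕ.≤ d → threshold d a < slack → 0ℚ < gap-slope
  gap-slope-pos 1≤d threshold<slack =
    subst (0ℚ <_) slope≡ (*-pos (*-pos 0<D 0<D) (p<q⇒0<q-p threshold<slack))
    where
    0<D : 0ℚ < D
    0<D = ιℤ-mono-< (+<+ 1≤d)
    slope≡ : D * D * (slack - threshold d a) ≡ gap-slope
    slope≡ = begin
      D * D * (slack - threshold d a)
        ≡⟨ ℚP.*-distribˡ-+ (D * D) slack (- threshold d a) ⟩
      D * D * slack + D * D * - threshold d a
        ≡⟨ cong (_+_ (D * D * slack)) (ℚP.neg-distribʳ-* (D * D) (threshold d a)) ⟨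
      D * D * slack - D * D * threshold d a
        ≡⟨ cong (λ t → D * D * slack - t) (scaled-threshold 1≤d a) ⟩
      gap-slope
        ∎
      where open ≡-Reasoning

  module AtScale (κ : ℚ) (n s e f : ℤ)
    (hn : ιℤ n ≡ a * κ) (hs : ιℤ s ≡ (a * (a * κ + ιℕ 1)) * ½)
    (he : ιℤ e ≡ u * κ) (hf : ιℤ f ≡ v * κ) where

    open ≡-Reasoning

    c : ℤ
    c = s ℤ.- n

    h : ℤ
    h = cardC n c ℤ.- + 2 ℤ.* e

    m : ℤ
    m = f ℤ.- h

    ιℤ-c : ιℤ c ≡ (a * ½) * ((a - ιℕ 2) * κ + 1ℚ)
    ιℤ-c = begin
      ιℤ (s ℤ.- n)                         ≡⟨ ιℤ-homo-minus s n ⟩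
      ιℤ s - ιℤ n                          ≡⟨ cong₂ _-_ hs hn ⟩
      (a * (a * κ + ιℕ 1)) * ½ - a * κ     ≡⟨ solve (a ∷ κ ∷ []) ℚ-ring ⟩
      (a * ½) * ((a - ιℕ 2) * κ + 1ℚ)      ∎

    ιℤ-n-c : ιℤ (n ℤ.- c) ≡ (a * ½) * ((ιℕ 4 - a) * κ - 1ℚ)
    ιℤ-n-c = begin
      ιℤ (n ℤ.- c)                               ≡⟨ ιℤ-homo-minus n c ⟩
      ιℤ n - ιℤ c                                ≡⟨ cong₂ _-_ hn ιℤ-c ⟩
      a * κ - (a * ½) * ((a - ιℕ 2) * κ + 1ℚ)    ≡⟨ solve (a ∷ κ ∷ []) ℚ-ring ⟩
      (a * ½) * ((ιℕ 4 - a) * κ - 1ℚ)            ∎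

    module _ (|C|≡ : cardC n c ≡ (n ℤ.- c) ℤ.+ + 1) where

      ιℤ-h : ιℤ h ≡ ((a * ½) * ((ιℕ 4 - a) * κ - 1ℚ) + 1ℚ) - ιℕ 2 * (u * κ)
      ιℤ-h = begin
        ιℤ (cardC n c ℤ.- + 2 ℤ.* e)
          ≡⟨ ιℤ-homo-minus (cardC n c) (+ 2 ℤ.* e) ⟩
        ιℤ (cardC n c) - ιℤ (+ 2 ℤ.* e)
          ≡⟨ cong₂ _-_ (trans (cong ιℤ |C|≡) (ιℤ-homo-+ (n ℤ.- c) (+ 1))) (ιℤ-homo-* (+ 2) e) ⟩
        (ιℤ (n ℤ.- c) + 1ℚ) - ιℕ 2 * ιℤ e
          ≡⟨ cong₂ (λ x y → (x + 1ℚ) - ιℕ 2 * y) ιℤ-n-c he ⟩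
        ((a * ½) * ((ιℕ 4 - a) * κ - 1ℚ) + 1ℚ) - ιℕ 2 * (u * κ)
          ∎

      ιℤ-m : ιℤ m ≡ slack * κ + (a * ½ - 1ℚ)
      ιℤ-m = begin
        ιℤ (f ℤ.- h)
          ≡⟨ ιℤ-homo-minus f h ⟩
        ιℤ f - ιℤ h
          ≡⟨ cong₂ _-_ hf ιℤ-h ⟩
        v * κ - (((a * ½) * ((ιℕ 4 - a) * κ - 1ℚ) + 1ℚ) - ιℕ 2 * (u * κ))
          ≡⟨ solve (a ∷ u ∷ v ∷ κ ∷ []) ℚ-ring ⟩
        (v - (ιℕ 2 * a - ½ * (a * a) - ιℕ 2 * u)) * κ + (a * ½ - 1ℚ)
          ∎

      ιℤ-2c-dm-1 : ιℤ (+ 2 ℤ.* c ℤ.- + d ℤ.* m ℤ.- + 1) ≡ ιℕ 2 * ιℤ c - D * ιℤ m - 1ℚ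
      ιℤ-2c-dm-1 = begin
        ιℤ (+ 2 ℤ.* c ℤ.- + d ℤ.* m ℤ.- + 1)
          ≡⟨ ιℤ-homo-minus (+ 2 ℤ.* c ℤ.- + d ℤ.* m) (+ 1) ⟩
        ιℤ (+ 2 ℤ.* c ℤ.- + d ℤ.* m) - 1ℚ
          ≡⟨ cong (_- 1ℚ) (ιℤ-homo-minus (+ 2 ℤ.* c) (+ d ℤ.* m)) ⟩
        ιℤ (+ 2 ℤ.* c) - ιℤ (+ d ℤ.* m) - 1ℚ
          ≡⟨ cong₂ (λ x y → x - y - 1ℚ) (ιℤ-homo-* (+ 2) c) (ιℤ-homo-* (+ d) m) ⟩
        ιℕ 2 * ιℤ c - D * ιℤ m - 1ℚ
          ∎

      ιℤ-gap : ιℤ (+ 2 ℤ.* s) - ιℤ (+ d ℤ.* (+ 2 ℤ.* c ℤ.- + d ℤ.* m ℤ.- + 1))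
               ≡ gap-slope * κ + gap-offset
      ιℤ-gap = begin
        ιℤ (+ 2 ℤ.* s) - ιℤ (+ d ℤ.* (+ 2 ℤ.* c ℤ.- + d ℤ.* m ℤ.- + 1))
          ≡⟨ cong₂ _-_ (ιℤ-homo-* (+ 2) s) (trans (ιℤ-homo-* (+ d) _) (cong (D *_) ιℤ-2c-dm-1)) ⟩
        ιℕ 2 * ιℤ s - D * (ιℕ 2 * ιℤ c - D * ιℤ m - 1ℚ)
          ≡⟨ cong₂ (λ x y → ιℕ 2 * x - D * (ιℕ 2 * y - D * ιℤ m - 1ℚ)) hs ιℤ-c ⟩
        ιℕ 2 * S - D * (ιℕ 2 * C - D * ιℤ m - 1ℚ)
          ≡⟨ cong (λ z → ιℕ 2 * S - D * (ιℕ 2 * C - D * z - 1ℚ)) ιℤ-m ⟩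
        ιℕ 2 * S - D * (ιℕ 2 * C - D * (slack * κ + (a * ½ - 1ℚ)) - 1ℚ)
          ≡⟨ affine-form a κ D slack ⟩
        gap-slope * κ + gap-offset
          ∎
        where
        S : ℚ
        S = (a * (a * κ + ιℕ 1)) * ½
        C : ℚ
        C = (a * ½) * ((a - ιℕ 2) * κ + 1ℚ)
        affine-form : ∀ a κ D δ →
          ιℕ 2 * ((a * (a * κ + ιℕ 1)) * ½)
            - D * (ιℕ 2 * ((a * ½) * ((a - ιℕ 2) * κ + 1ℚ)) - D * (δ * κ + (a * ½ - 1ℚ)) - 1ℚ)
          ≡ (D * D * δ - ((D - 1ℚ) * (a * a) - ιℕ 2 * a * D)) * κ + (a - D * ((a - 1ℚ) - D * (a * ½ - 1ℚ)))
        affine-form = solve-∀ ℚ-ring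

  conditions-hold : ιℕ 2 < a → 0ℚ < slack → ∀ k →
    0ℚ < (ιℕ 4 - a) * ιℕ k - 1ℚ → 0ℚ < gap-slope * ιℕ k + gap-offset →
    (n s e f : ℤ) →
    ιℤ n ≡ a * ιℕ k → ιℤ s ≡ (a * (a * ιℕ k + ιℕ 1)) * ½ →
    ιℤ e ≡ u * ιℕ k → ιℤ f ≡ v * ιℕ k →
    let c = s ℤ.- n
        h = cardC n c ℤ.- + 2 ℤ.* e
    in (h ℤ.< f) × (sumFromTo (c ℤ.- + d ℤ.* (f ℤ.- h)) (c ℤ.- + 1) ℤ.< (f ℤ.- h) ℤ.* s)
  conditions-hold 2<a 0<slack k 0<[4-a]k-1 0<gap n s e f hn hs he hf = h<f , sum<
    where
    open AtScale (ιℕ k) n s e f hn hs he hf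
    0≤k : 0ℚ ≤ ιℕ k
    0≤k = ιℤ-mono-≤ (+≤+ (z≤n {k}))
    0<a-2 : 0ℚ < a - ιℕ 2
    0<a-2 = p<q⇒0<q-p 2<a
    0<a/2 : 0ℚ < a * ½
    0<a/2 = *-pos (ℚP.<-trans (ιℤ-mono-< (+<+ (s≤s (z≤n {1})))) 2<a) (ℚP.positive⁻¹ ½)
    0<a/2-1 : 0ℚ < a * ½ - 1ℚ
    0<a/2-1 = subst (0ℚ <_) [a-2]/2≡a/2-1 (*-pos 0<a-2 (ℚP.positive⁻¹ ½))
      where
      [a-2]/2≡a/2-1 : (a - ιℕ 2) * ½ ≡ a * ½ - 1ℚ
      [a-2]/2≡a/2-1 = solve (a ∷ []) ℚ-ring
    0<c : + 0 ℤ.< c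
    0<c = ιℤ-cancel-< (subst (0ℚ <_) (sym ιℤ-c)
            (*-pos 0<a/2 (+-nonNeg-pos (*-nonNeg (ℚP.<⇒≤ 0<a-2) 0≤k) (ℚP.positive⁻¹ 1ℚ))))
    c≤n : c ℤ.≤ n
    c≤n = ℤP.0≤i-j⇒j≤i
            (ιℤ-cancel-≤ (subst (0ℚ ≤_) (sym ιℤ-n-c) (ℚP.<⇒≤ (*-pos 0<a/2 0<[4-a]k-1))))
    |C|≡ : cardC n c ≡ (n ℤ.- c) ℤ.+ + 1
    |C|≡ = cardC≡ n c 0<c c≤n
    0<ιm : 0ℚ < ιℤ m
    0<ιm = subst (0ℚ <_) (sym (ιℤ-m |C|≡)) (+-nonNeg-pos (*-nonNeg (ℚP.<⇒≤ 0<slack) 0≤k) 0<a/2-1)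
    h<f : h ℤ.< f
    h<f = ιℤ-cancel-< (0<q-p⇒p<q (subst (0ℚ <_) (ιℤ-homo-minus f h) 0<ιm))
    sum< : sumFromTo (c ℤ.- + d ℤ.* m) (c ℤ.- + 1) ℤ.< m ℤ.* s
    sum< = sumFromTo-below-< d c m s (ιℤ-cancel-< {+ 0} 0<ιm)
             (ιℤ-cancel-< (0<q-p⇒p<q (subst (0ℚ <_) (sym (ιℤ-gap |C|≡)) 0<gap)))

lemma2p14 : (d : ℕ) → 3 ℕ.≤ d → (a u v : ℚ) →
    ιℕ 2 < a → a < ιℕ 4 →
    (ιℕ 2 * a) - (½ * (a * a))
      + (0ℚ ⊔ ((ιℕ (d ℕ.∸ 1) * (a * a)) * (recipℕ d * recipℕ d) - (ιℕ 2 * a) * recipℕ d))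
      - ιℕ 2 * u < v →
    ∃ λ (K : ℕ) → (k : ℕ) → K ℕ.≤ k →
      (n s e f : ℤ) →
      ιℤ n ≡ a * ιℕ k →
      ιℤ s ≡ (a * (a * ιℕ k + ιℕ 1)) * ½ →
      ιℤ e ≡ u * ιℕ k →
      ιℤ f ≡ v * ιℕ k →
      let c = s ℤ.- n
          h = cardC n c ℤ.- + 2 ℤ.* e
      in (h ℤ.< f)
         × (sumFromTo (c ℤ.- + d ℤ.* (f ℤ.- h)) (c ℤ.- + 1) ℤ.< (f ℤ.- h) ℤ.* s)
lemma2p14 d d≥3 a u v 2<a a<4 hyp =
  eventually-mono (λ k (0<[4-a]k-1 , 0<gap) → conditions-hold d a u v 2<a 0<slack k 0<[4-a]k-1 0<gap)
    (eventually-× (affine-eventually-pos (ιℕ 4 - a) (- 1ℚ) (p<q⇒0<q-p a<4))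
                  (affine-eventually-pos (gap-slope d a u v) (gap-offset d a u v)
                                         (gap-slope-pos d a u v d≥1 threshold<slack)))
  where
  d≥1 : 1 ℕ.≤ d
  d≥1 = ℕP.≤-trans (s≤s z≤n) d≥3
  max<slack : 0ℚ ⊔ threshold d a < slack d a u v
  max<slack = p+q-r<s⇒q<s-[p-r] {ιℕ 2 * a - ½ * (a * a)} {r = ιℕ 2 * u} hyp
  0<slack : 0ℚ < slack d a u v
  0<slack = ℚP.≤-<-trans (ℚP.p≤p⊔q 0ℚ (threshold d a)) max<slack
  threshold<slack : threshold d a < slack d a u v
  threshold<slack = ℚP.≤-<-trans (ℚP.p≤q⊔p 0ℚ (threshold d a)) max<slack
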